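{- Let $d,r,s$ be positive integers, $q$ a prime power, $V=\mathbb{F}_q^s$, and let $T_1,\ldots,T_r$ be independent uniformly random multilinear functions $V^d\to\mathbb{F}_q$. Let $\mathcal{E}$ be the set of all $(v_1,\ldots,v_d)\in V^d$ with $T_i(v_1,\ldots,v_d)=1$ for all $i$, and let $\mathcal{F}$ be the set of all $(v_1^0,v_1^1,\ldots,v_d^0,v_d^1)\in V^{2d}$ such that $v_j^0\neq v_j^1$ for all $j$ and $T_i(v_1^{\varepsilon_1},\ldots,v_d^{\varepsilon_d})=1$ for all $i=1,\ldots,r$ and all $\varepsilon_1,\ldots,\varepsilon_d\in\{0,1\}$. Let $\mathcal{B}$ be the set of all $(v_1,\ldots,v_d)\in\mathcal{E}$ for which there exists $(v_1',\ldots,v_d')\in V^d$ with $(v_1,v_1',\ldots,v_d,v_d')\in\mathcal{F}$. Then $$\mathbb{E}[|\mathcal{B}|]\le (1+o(1))\, q^{ -d}\,\mathbb{E}[|\mathcal{F}|],$$ where $o(1)\to 0$ as $q\to\infty$ (with $d,r,s$ fixed).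
   Context: A multilinear function $V^d\to\mathbb{F}_q$ is one that is linear in each argument when the others are fixed; a uniformly random one is an element of $(V^*)^{\otimes d}$ chosen uniformly at random. -}

module Defs where

open import Level using (0ℓ)
open import Data.Bool using (Bool; true; false; _∧_; if_then_else_; not)
open import Data.Nat as ℕ using (ℕ; zero; suc; _^_)
open import Data.Fin using (Fin)
open import Data.List as L using (List; []; _∷_; length; filterᵇ; concatMap; map)
open import Data.Bool.ListAction using (all; any)
open import Data.Nat.ListAction using (sum)
open import Data.List.Membership.Propositional using (_∈_)
open import Data.List.Relation.Unary.Unique.Propositional using (Unique)
open import Data.Vec as V using (Vec; []; _∷_; lookup; allFin; zip)
open import Data.Vec.Properties using (≡-dec)
open import Data.Product using (_×_; _,_; proj₁; proj₂; ∃)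
open import Data.Integer using (+_)
open import Data.Rational using (ℚ; _/_)
open import Relation.Nullary using (¬_; does)
open import Relation.Binary.PropositionalEquality using (_≡_)
open import Relation.Binary.Definitions using (DecidableEquality)
open import Algebra.Structures using (IsCommutativeRing)

-- Finite fields (equality is propositional equality; every finite field
-- is isomorphic to one of this form).  Its order q = length elements is
-- automatically a prime power, and every prime power arises.

record FiniteField : Set₁ where
  field
    Carrier : Set
    _+_ _*_ : Carrier → Carrier → Carrier
    -_      : Carrier → Carrier
    0# 1#   : Carrier
    isCommutativeRing : IsCommutativeRing _≡_ _+_ _*_ -_ 0# 1#
    0≢1     : ¬ (0# ≡ 1#)
    inverse : ∀ x → ¬ (x ≡ 0#) → ∃ λ y → x * y ≡ 1#
    _≟_     : DecidableEquality Carrier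
    elements : List Carrier
    complete : ∀ x → x ∈ elements
    unique   : Unique elements

  order : ℕ
  order = length elements

vecsOver : ∀ {X : Set} → List X → (n : ℕ) → List (Vec X n)
vecsOver xs zero    = [] ∷ []
vecsOver xs (suc n) = concatMap (λ x → map (x ∷_) (vecsOver xs n)) xs

count : ∀ {X : Set} → (X → Bool) → List X → ℕ
count p xs = length (filterᵇ p xs)

-- a / b as a rational (b is never 0 where used below)
_÷_ : ℕ → ℕ → ℚ
a ÷ zero  = + 0 / 1
a ÷ suc b = + a / suc b

allBool : List Bool
allBool = false ∷ true ∷ []

module Setting (𝔽 : FiniteField) (s : ℕ) where
  open FiniteField 𝔽

  Vs : Set
  Vs = Vec Carrier s

  allV : List Vs
  allV = vecsOver elements s

  _≟V_ : DecidableEquality Vs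
  _≟V_ = ≡-dec _≟_

  sumFin : ∀ {n} → (Fin n → Carrier) → Carrier
  sumFin f = V.foldr (λ _ → Carrier) _+_ 0# (V.tabulate f)

  -- Elements of (V*)^{⊗d}: coefficient tensors, s × s × ⋯ × s (d times)
  Tensor : ℕ → Set
  Tensor zero    = Carrier
  Tensor (suc d) = Vec (Tensor d) s

  allTensors : (d : ℕ) → List (Tensor d)
  allTensors zero    = elements
  allTensors (suc d) = vecsOver (allTensors d) s

  eval : ∀ {d} → Tensor d → Vec Vs d → Carrier
  eval {zero}  c []       = c
  eval {suc d} t (v ∷ vs) = sumFin (λ i → lookup v i * eval (lookup t i) vs)

  isOne : Carrier → Bool
  isOne x = does (x ≟ 1#)

  module _ (d r : ℕ) where
    -- r-tuples (T₁,…,T_r) of multilinear functions; the uniform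
    -- distribution on this list = independent uniform T_i
    allTs : List (Vec (Tensor d) r)
    allTs = vecsOver (allTensors d) r

    allVd : List (Vec Vs d)
    allVd = vecsOver allV d

    allPairs : List (Vec (Vs × Vs) d)
    allPairs = vecsOver (L.cartesianProduct allV allV) d

    allEps : List (Vec Bool d)
    allEps = vecsOver allBool d

    allOneAt : Vec (Tensor d) r → Vec Vs d → Bool
    allOneAt Ts v = V.foldr (λ _ → Bool) (λ T b → isOne (eval T v) ∧ b) true Ts

    inE : Vec (Tensor d) r → Vec Vs d → Bool
    inE = allOneAt

    select : Vec (Vs × Vs) d → Vec Bool d → Vec Vs d
    select ps ε = V.zipWith (λ p e → if e then proj₂ p else proj₁ p) ps ε

    distinctPairs : Vec (Vs × Vs) d → Bool
    distinctPairs ps =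
      V.foldr (λ _ → Bool) (λ p b → not (does (proj₁ p ≟V proj₂ p)) ∧ b) true ps

    -- membership in ℱ: a tuple (v₁⁰,v₁¹,…,v_d⁰,v_d¹) is stored as the
    -- vector of pairs ((v₁⁰,v₁¹),…,(v_d⁰,v_d¹))
    inF : Vec (Tensor d) r → Vec (Vs × Vs) d → Bool
    inF Ts ps = distinctPairs ps ∧ all (λ ε → allOneAt Ts (select ps ε)) allEps

    inB : Vec (Tensor d) r → Vec Vs d → Bool
    inB Ts v = inE Ts v ∧ any (λ v' → inF Ts (zip v v')) allVd

    sizeE sizeF sizeB : Vec (Tensor d) r → ℕ
    sizeE Ts = count (inE Ts) allVd
    sizeF Ts = count (inF Ts) allPairs
    sizeB Ts = count (inB Ts) allVd

    expect : (Vec (Tensor d) r → ℕ) → ℚ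
    expect f = sum (map f allTs) ÷ length allTs

    EB EF : ℚ
    EB = expect sizeB
    EF = expect sizeF

module Submission where

-- For fixed T₁, …, T_r we show |ℬ| (q − 1)^d ≤ |ℱ|.  Given v ∈ ℬ, fix w with (v, w) ∈ ℱ.  A
-- multilinear T is affine along every line in each argument, so for λ ∈ (𝔽^×)^d its value at a
-- corner of the box with sides v_j, v_j + λ_j (w_j − v_j) is an affine combination of its values
-- at the corners of the box with sides v_j, w_j, all of which are 1.  Since v_j ≠ w_j and λ_j ≠ 0
-- this gives a point of ℱ, and (v, λ) ↦ (v, v + λ (w − v)) is injective.  Averaging over the T_i,
-- it remains to see q^d ≤ (1 + 1/K) (q − 1)^d once q − 1 ≥ (K + 1) d, which follows from
-- (m + 1)^d − m^d ≤ d (m + 1)^(d − 1); choosing K the denominator of ε makes 1/K ≤ ε.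

open import Defs
open import Data.Nat using (ℕ)

module Enumeration where

  open import Data.Bool using (Bool; true; false; T)
  open import Data.Maybe using (fromMaybe)
  open import Data.Nat using (zero; suc; _+_; _*_; _^_; _≤_; z≤n; s≤s)
  open import Data.Nat.Properties using (≤-trans; ≤-reflexive; +-mono-≤; *-distribʳ-+; module ≤-Reasoning)
  open import Data.List using (List; []; _∷_; _++_; length; map; concatMap; cartesianProductWith; findᵇ)
  open import Data.List.Properties using (length-++; length-map; length-removeAt′)
  open import Data.Nat.ListAction using (sum)
  open import Data.Bool.ListAction using (any)
  open import Data.List.Membership.Propositional using (_∈_; _─_)
  open import Data.List.Membership.Propositional.Properties
    using (∈-map⁻; ∈-cartesianProductWith⁺; ∈-cartesianProductWith⁻)
  open import Data.List.Relation.Unary.Any using (here; there; index)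
  import Data.List.Relation.Unary.All as ListAll
  import Data.List.Relation.Unary.All.Properties as ListAll
  open import Data.List.Relation.Unary.AllPairs using ([]; _∷_)
  open import Data.List.Relation.Unary.Unique.Propositional using (Unique)
  import Data.List.Relation.Unary.Unique.Propositional.Properties as Unique
  open import Data.Vec using (Vec; []; _∷_; zip; unzip)
  open import Data.Vec.Properties using (∷-injective; unzip∘zip)
  open import Data.Vec.Relation.Unary.All using (All; []; _∷_)
  open import Data.Product using (_,_)
  open import Data.Empty using (⊥-elim)
  open import Function using (case_of_)
  open import Relation.Binary.PropositionalEquality

  private variable
    A B C : Set
    n : ℕ

  length-cartesianProductWith : (f : A → B → C) (xs : List A) (ys : List B) →
    length (cartesianProductWith f xs ys) ≡ length xs * length ys
  length-cartesianProductWith f []       ys = refl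
  length-cartesianProductWith f (x ∷ xs) ys = begin
    length (map (f x) ys ++ cartesianProductWith f xs ys) ≡⟨ length-++ (map (f x) ys) ⟩
    length (map (f x) ys) + length (cartesianProductWith f xs ys)
      ≡⟨ cong₂ _+_ (length-map (f x) ys) (length-cartesianProductWith f xs ys) ⟩
    length ys + length xs * length ys ∎
    where open ≡-Reasoning

  vecsOver-suc : (xs : List A) (n : ℕ) →
    vecsOver xs (suc n) ≡ cartesianProductWith _∷_ xs (vecsOver xs n)
  vecsOver-suc xs n = go xs
    where
    go : ∀ ys → concatMap (λ y → map (y ∷_) (vecsOver xs n)) ys ≡ cartesianProductWith _∷_ ys (vecsOver xs n)
    go []       = refl
    go (y ∷ ys) = cong (map (y ∷_) (vecsOver xs n) ++_) (go ys)

  ∈-vecsOver⁺ : {xs : List A} {v : Vec A n} → All (_∈ xs) v → v ∈ vecsOver xs n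
  ∈-vecsOver⁺ []       = here refl
  ∈-vecsOver⁺ {xs = xs} {v = _ ∷ v} (x∈ ∷ v∈) =
    subst (_ ∈_) (sym (vecsOver-suc xs _)) (∈-cartesianProductWith⁺ _∷_ x∈ (∈-vecsOver⁺ v∈))

  ∈-vecsOver⁻ : (xs : List A) {v : Vec A n} → v ∈ vecsOver xs n → All (_∈ xs) v
  ∈-vecsOver⁻ xs {[]}    _ = []
  ∈-vecsOver⁻ xs {x ∷ v} m
    with _ , _ , x∈ , v∈ , refl ← ∈-cartesianProductWith⁻ _∷_ xs (vecsOver xs _) (subst (_ ∈_) (vecsOver-suc xs _) m)
    = x∈ ∷ ∈-vecsOver⁻ xs v∈

  vecsOver⁺ : {xs : List A} → Unique xs → Unique (vecsOver xs n)
  vecsOver⁺ {n = zero}  _  = ListAll.[] ∷ []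
  vecsOver⁺ {n = suc n} {xs = xs} u = subst Unique (sym (vecsOver-suc xs n))
    (Unique.cartesianProductWith⁺ _∷_ ∷-injective u (vecsOver⁺ u))

  length-vecsOver : (xs : List A) (n : ℕ) → length (vecsOver xs n) ≡ length xs ^ n
  length-vecsOver xs zero    = refl
  length-vecsOver xs (suc n) = begin
    length (vecsOver xs (suc n)) ≡⟨ cong length (vecsOver-suc xs n) ⟩
    length (cartesianProductWith _∷_ xs (vecsOver xs n)) ≡⟨ length-cartesianProductWith _∷_ xs _ ⟩
    length xs * length (vecsOver xs n) ≡⟨ cong (length xs *_) (length-vecsOver xs n) ⟩
    length xs * length xs ^ n ∎
    where open ≡-Reasoning

  findᵇ-satisfies : (p : A → Bool) (default : A) (xs : List A) →
    T (any p xs) → T (p (fromMaybe default (findᵇ p xs)))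
  findᵇ-satisfies p default (x ∷ xs) h with p x in eq
  ... | true  = subst T (sym eq) _
  ... | false = findᵇ-satisfies p default xs h

  ∈-─⁺ : {x z : A} {ys : List A} (x∈ys : x ∈ ys) → z ∈ ys → z ≢ x → z ∈ ys ─ x∈ys
  ∈-─⁺ (here refl) (here refl) z≢x = ⊥-elim (z≢x refl)
  ∈-─⁺ (here refl) (there z∈)  _   = z∈
  ∈-─⁺ (there _)   (here refl) _   = here refl
  ∈-─⁺ (there x∈)  (there z∈)  z≢x = there (∈-─⁺ x∈ z∈ z≢x)

  Unique-⊆⇒length-≤ : {xs ys : List A} → Unique xs → (∀ {z} → z ∈ xs → z ∈ ys) → length xs ≤ length ys
  Unique-⊆⇒length-≤ {xs = []}     _             _   = z≤n
  Unique-⊆⇒length-≤ {xs = x ∷ xs} {ys} (x∉xs ∷ u) sub = begin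
    suc (length xs)           ≤⟨ s≤s (Unique-⊆⇒length-≤ u xs⊆ys─x) ⟩
    suc (length (ys ─ x∈ys))  ≡⟨ length-removeAt′ ys (index x∈ys) ⟨
    length ys                 ∎
    where
    open ≤-Reasoning
    x∈ys = sub (here refl)
    xs⊆ys─x : ∀ {z} → z ∈ xs → z ∈ ys ─ x∈ys
    xs⊆ys─x z∈ = ∈-─⁺ x∈ys (sub (there z∈)) (≢-sym (ListAll.lookup x∉xs z∈))

  map⁺-injectiveOn : (f : A → B) {xs : List A} → Unique xs →
    (∀ {x y} → x ∈ xs → y ∈ xs → f x ≡ f y → x ≡ y) → Unique (map f xs)
  map⁺-injectiveOn f {[]}     []         _   = []
  map⁺-injectiveOn f {x ∷ xs} (x∉xs ∷ u) inj =
    ListAll.map⁺ (ListAll.tabulate λ y∈ fx≡fy → ListAll.lookup x∉xs y∈ (inj (here refl) (there y∈) fx≡fy))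
    ∷ map⁺-injectiveOn f u (λ x∈ y∈ → inj (there x∈) (there y∈))

  length-≤-injectiveOn : (f : A → B) {xs : List A} {ys : List B} → Unique xs →
    (∀ {x} → x ∈ xs → f x ∈ ys) → (∀ {x y} → x ∈ xs → y ∈ xs → f x ≡ f y → x ≡ y) →
    length xs ≤ length ys
  length-≤-injectiveOn f {xs} u f∈ inj = ≤-trans (≤-reflexive (sym (length-map f xs)))
    (Unique-⊆⇒length-≤ (map⁺-injectiveOn f u inj) λ z∈ → case ∈-map⁻ f z∈ of λ where
      (x , x∈ , refl) → f∈ x∈)

  zip-injective : {v v′ : Vec A n} {u u′ : Vec B n} → zip v u ≡ zip v′ u′ → (v , u) ≡ (v′ , u′)
  zip-injective {v = v} {v′} {u} {u′} eq = trans (sym (unzip∘zip v u)) (trans (cong unzip eq) (unzip∘zip v′ u′))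

  sum-map-*-≤ : (xs : List A) (f g : A → ℕ) (M : ℕ) →
    (∀ x → f x * M ≤ g x) → sum (map f xs) * M ≤ sum (map g xs)
  sum-map-*-≤ []       f g M _ = z≤n
  sum-map-*-≤ (x ∷ xs) f g M f*M≤g = begin
    (f x + sum (map f xs)) * M      ≡⟨ *-distribʳ-+ M (f x) _ ⟩
    f x * M + sum (map f xs) * M    ≤⟨ +-mono-≤ (f*M≤g x) (sum-map-*-≤ xs f g M f*M≤g) ⟩
    g x + sum (map g xs)            ∎
    where open ≤-Reasoning

module LineMap (𝔽 : FiniteField) where

  open import Algebra.Bundles using (CommutativeRing)
  open import Data.Product using (_,_)
  open import Data.Vec as Vec using (Vec; []; _∷_)
  open import Data.Vec.Properties using (∷-injectiveˡ; ∷-injectiveʳ)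
  open import Data.Vec.Relation.Unary.All using (All; []; _∷_)
  open import Data.Vec.Relation.Binary.Pointwise.Inductive using (Pointwise; []; _∷_)
  open import Function using (_∘_)
  open import Relation.Binary.PropositionalEquality
  open import Relation.Nullary using (yes; no)
  open import Data.Empty using (⊥-elim)

  open FiniteField 𝔽 using (Carrier; _≟_; inverse)

  commutativeRing : CommutativeRing _ _
  commutativeRing = record { isCommutativeRing = FiniteField.isCommutativeRing 𝔽 }

  open CommutativeRing commutativeRing
    using ( _+_; _*_; -_; _-_; 0#; 1#; *-comm; *-assoc; *-identityʳ; zeroˡ; zeroʳ
          ; distribˡ; distribʳ; +-identityʳ; -‿inverseʳ; +-group; +-abelianGroup; +-commutativeSemigroup; ring )
  open import Algebra.Properties.Group +-group using (x∙y⁻¹≈ε⇒x≈y; ∙-cancelˡ)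
  open import Algebra.Properties.AbelianGroup +-abelianGroup using (⁻¹-∙-comm)
  open import Algebra.Properties.CommutativeSemigroup +-commutativeSemigroup using (interchange)
  open import Algebra.Properties.Ring ring using ([y-z]x≈yx-zx)
  open ≡-Reasoning

  private variable
    n : ℕ

  lineMap : Carrier → Carrier → Carrier → Carrier
  lineMap a b l = a + l * (b - a)

  lineMap-+ : ∀ a b c d l → lineMap a b l + lineMap c d l ≡ lineMap (a + c) (b + d) l
  lineMap-+ a b c d l = begin
    (a + l * (b - a)) + (c + l * (d - c))  ≡⟨ interchange a _ c _ ⟩
    (a + c) + (l * (b - a) + l * (d - c))  ≡⟨ cong ((a + c) +_) (distribˡ l (b - a) (d - c)) ⟨
    (a + c) + l * ((b - a) + (d - c))      ≡⟨ cong (λ t → (a + c) + l * t) (interchange b (- a) d (- c)) ⟩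
    (a + c) + l * ((b + d) + (- a + - c))  ≡⟨ cong (λ t → (a + c) + l * ((b + d) + t)) (⁻¹-∙-comm a c) ⟩
    (a + c) + l * ((b + d) - (a + c))      ∎

  lineMap-*ʳ : ∀ a b c l → lineMap a b l * c ≡ lineMap (a * c) (b * c) l
  lineMap-*ʳ a b c l = begin
    (a + l * (b - a)) * c       ≡⟨ distribʳ c a (l * (b - a)) ⟩
    a * c + (l * (b - a)) * c   ≡⟨ cong (a * c +_) (*-assoc l (b - a) c) ⟩
    a * c + l * ((b - a) * c)   ≡⟨ cong (λ t → a * c + l * t) ([y-z]x≈yx-zx c b a) ⟩
    a * c + l * (b * c - a * c) ∎

  lineMap-*ˡ : ∀ a b c l → c * lineMap a b l ≡ lineMap (c * a) (c * b) l
  lineMap-*ˡ a b c l = begin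
    c * lineMap a b l          ≡⟨ *-comm c _ ⟩
    lineMap a b l * c          ≡⟨ lineMap-*ʳ a b c l ⟩
    lineMap (a * c) (b * c) l  ≡⟨ cong₂ (λ x y → lineMap x y l) (*-comm a c) (*-comm b c) ⟩
    lineMap (c * a) (c * b) l  ∎

  lineMap-const : ∀ a l → lineMap a a l ≡ a
  lineMap-const a l = begin
    a + l * (a - a)  ≡⟨ cong (λ t → a + l * t) (-‿inverseʳ a) ⟩
    a + l * 0#       ≡⟨ cong (a +_) (zeroʳ l) ⟩
    a + 0#           ≡⟨ +-identityʳ a ⟩
    a                ∎

  lineMap-zero : ∀ a b → lineMap a b 0# ≡ a
  lineMap-zero a b = trans (cong (a +_) (zeroˡ (b - a))) (+-identityʳ a)

  x*y≡0⇒x≡0 : ∀ {x y} → x * y ≡ 0# → y ≢ 0# → x ≡ 0#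
  x*y≡0⇒x≡0 {x} {y} xy≡0 y≢0 with z , yz≡1 ← inverse y y≢0 = begin
    x            ≡⟨ *-identityʳ x ⟨
    x * 1#       ≡⟨ cong (x *_) yz≡1 ⟨
    x * (y * z)  ≡⟨ *-assoc x y z ⟨
    (x * y) * z  ≡⟨ cong (_* z) xy≡0 ⟩
    0# * z       ≡⟨ zeroˡ z ⟩
    0#           ∎

  lineMap-injective : ∀ {a b l l′} → b ≢ a → lineMap a b l ≡ lineMap a b l′ → l ≡ l′
  lineMap-injective {a} {b} {l} {l′} b≢a eq = x∙y⁻¹≈ε⇒x≈y l l′
    (x*y≡0⇒x≡0 [l-l′][b-a]≡0 (b≢a ∘ x∙y⁻¹≈ε⇒x≈y b a))
    where
    [l-l′][b-a]≡0 : (l - l′) * (b - a) ≡ 0#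
    [l-l′][b-a]≡0 = begin
      (l - l′) * (b - a)             ≡⟨ [y-z]x≈yx-zx (b - a) l l′ ⟩
      l * (b - a) - l′ * (b - a)     ≡⟨ cong (_- l′ * (b - a)) (∙-cancelˡ a _ _ eq) ⟩
      l′ * (b - a) - l′ * (b - a)    ≡⟨ -‿inverseʳ _ ⟩
      0#                             ∎

  lineMapᵥ : Vec Carrier n → Vec Carrier n → Carrier → Vec Carrier n
  lineMapᵥ x y l = Vec.zipWith (λ a b → lineMap a b l) x y

  lineMapᵥ-zero : ∀ (x y : Vec Carrier n) → lineMapᵥ x y 0# ≡ x
  lineMapᵥ-zero []      []      = refl
  lineMapᵥ-zero (a ∷ x) (b ∷ y) = cong₂ _∷_ (lineMap-zero a b) (lineMapᵥ-zero x y)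

  lineMapᵥ-injective : ∀ {x y : Vec Carrier n} {l l′} → x ≢ y → lineMapᵥ x y l ≡ lineMapᵥ x y l′ → l ≡ l′
  lineMapᵥ-injective {x = []}    {[]}    x≢y _  = ⊥-elim (x≢y refl)
  lineMapᵥ-injective {x = a ∷ x} {b ∷ y} x≢y eq with b ≟ a
  ... | no  b≢a  = lineMap-injective b≢a (∷-injectiveˡ eq)
  ... | yes refl = lineMapᵥ-injective (x≢y ∘ cong (a ∷_)) (∷-injectiveʳ eq)

  lineMapᵥ-≢ : ∀ {x y : Vec Carrier n} {l} → x ≢ y → l ≢ 0# → x ≢ lineMapᵥ x y l
  lineMapᵥ-≢ {x = x} {y} x≢y l≢0 x≡ = l≢0 (sym (lineMapᵥ-injective x≢y (trans (lineMapᵥ-zero x y) x≡)))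

  lineMaps : ∀ {m} → Vec (Vec Carrier m) n → Vec (Vec Carrier m) n → Vec Carrier n → Vec (Vec Carrier m) n
  lineMaps []      []      []       = []
  lineMaps (x ∷ v) (y ∷ w) (l ∷ ls) = lineMapᵥ x y l ∷ lineMaps v w ls

  lineMaps-injective : ∀ {m} {v w : Vec (Vec Carrier m) n} {ls ls′} →
    Pointwise _≢_ v w → lineMaps v w ls ≡ lineMaps v w ls′ → ls ≡ ls′
  lineMaps-injective {ls = []}    {[]}     []            _  = refl
  lineMaps-injective {ls = _ ∷ _} {_ ∷ _} (x≢y ∷ v≢w) eq =
    cong₂ _∷_ (lineMapᵥ-injective x≢y (∷-injectiveˡ eq)) (lineMaps-injective v≢w (∷-injectiveʳ eq))

  lineMaps-≢ : ∀ {m} {v w : Vec (Vec Carrier m) n} {ls} →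
    Pointwise _≢_ v w → All (_≢ 0#) ls → Pointwise _≢_ v (lineMaps v w ls)
  lineMaps-≢ []            []            = []
  lineMaps-≢ (x≢y ∷ v≢w) (l≢0 ∷ ls≢0) = lineMapᵥ-≢ x≢y l≢0 ∷ lineMaps-≢ v≢w ls≢0

module MultiAffine (𝔽 : FiniteField) (s : ℕ) where

  open import Data.Bool using (Bool; true; false; if_then_else_)
  open import Data.Nat using (zero; suc)
  open import Data.Fin as Fin using (Fin)
  open import Data.Product using (_×_; _,_; proj₁; proj₂)
  open import Data.Unit using (⊤; tt)
  open import Data.Vec as Vec using (Vec; []; _∷_; lookup)
  open import Data.Vec.Properties using (tabulate-cong; lookup-zipWith)
  open import Function using (_∘_)
  open import Relation.Binary.PropositionalEquality

  open FiniteField 𝔽 using (Carrier; _+_; _*_; 0#)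
  open Setting 𝔽 s using (Vs; Tensor; eval; sumFin)
  open LineMap 𝔽

  private variable
    n : ℕ

  MultiAffine : (n : ℕ) → (Vec Vs n → Carrier) → Set
  MultiAffine zero    f = ⊤
  MultiAffine (suc n) f =
    (∀ x y l r → f (lineMapᵥ x y l ∷ r) ≡ lineMap (f (x ∷ r)) (f (y ∷ r)) l) ×
    (∀ x → MultiAffine n (f ∘ (x ∷_)))

  sumFin-cong : ∀ {m} {f g : Fin m → Carrier} → (∀ i → f i ≡ g i) → sumFin f ≡ sumFin g
  sumFin-cong f≗g = cong (Vec.foldr _ _+_ 0#) (tabulate-cong f≗g)

  sumFin-lineMap : ∀ {m} (a b : Fin m → Carrier) l →
    sumFin (λ i → lineMap (a i) (b i) l) ≡ lineMap (sumFin a) (sumFin b) l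
  sumFin-lineMap {zero}  a b l = sym (lineMap-const 0# l)
  sumFin-lineMap {suc m} a b l = trans
    (cong (lineMap (a Fin.zero) (b Fin.zero) l +_) (sumFin-lineMap (a ∘ Fin.suc) (b ∘ Fin.suc) l))
    (lineMap-+ (a Fin.zero) (b Fin.zero) _ _ l)

  multiAffine-linearCombination : ∀ n (c : Fin s → Carrier) (f : Fin s → Vec Vs n → Carrier) →
    (∀ i → MultiAffine n (f i)) → MultiAffine n (λ r → sumFin (λ i → c i * f i r))
  multiAffine-linearCombination zero    c f _     = tt
  multiAffine-linearCombination (suc n) c f affine = along-first , λ x →
    multiAffine-linearCombination n c (λ i → f i ∘ (x ∷_)) (λ i → proj₂ (affine i) x)
    where
    along-first : ∀ x y l r → sumFin (λ i → c i * f i (lineMapᵥ x y l ∷ r)) ≡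
      lineMap (sumFin (λ i → c i * f i (x ∷ r))) (sumFin (λ i → c i * f i (y ∷ r))) l
    along-first x y l r = trans
      (sumFin-cong λ i → trans (cong (c i *_) (proj₁ (affine i) x y l r)) (lineMap-*ˡ _ _ (c i) l))
      (sumFin-lineMap (λ i → c i * f i (x ∷ r)) (λ i → c i * f i (y ∷ r)) l)

  eval-multiAffine : ∀ n (t : Tensor n) → MultiAffine n (eval t)
  eval-multiAffine zero    t = tt
  eval-multiAffine (suc n) t = along-first , λ x →
    multiAffine-linearCombination n (lookup x) (eval ∘ lookup t) (eval-multiAffine n ∘ lookup t)
    where
    along-first : ∀ x y l r → eval t (lineMapᵥ x y l ∷ r) ≡ lineMap (eval t (x ∷ r)) (eval t (y ∷ r)) l
    along-first x y l r = trans
      (sumFin-cong λ i → trans (cong (_* eval (lookup t i) r) (lookup-zipWith _ i x y)) (lineMap-*ʳ _ _ _ l))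
      (sumFin-lineMap (λ i → lookup x i * eval (lookup t i) r) (λ i → lookup y i * eval (lookup t i) r) l)

  corner : ∀ {A : Set} → Vec A n → Vec A n → Vec Bool n → Vec A n
  corner []      []      []      = []
  corner (a ∷ v) (b ∷ w) (e ∷ ε) = (if e then b else a) ∷ corner v w ε

  multiAffine-corners : ∀ n {f} → MultiAffine n f → ∀ {c} (v w : Vec Vs n) ls →
    (∀ ε → f (corner v w ε) ≡ c) → ∀ ε → f (corner v (lineMaps v w ls) ε) ≡ c
  multiAffine-corners zero    _               []      []      []       f≡c []          = f≡c []
  multiAffine-corners (suc n) (_ , affine) (x ∷ v) (y ∷ w) (l ∷ ls) f≡c (false ∷ ε) =
    multiAffine-corners n (affine x) v w ls (f≡c ∘ (false ∷_)) ε
  multiAffine-corners (suc n) (along-first , affine) {c} (x ∷ v) (y ∷ w) (l ∷ ls) f≡c (true ∷ ε) = begin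
    _                  ≡⟨ along-first x y l _ ⟩
    lineMap _ _ l      ≡⟨ cong₂ (λ a b → lineMap a b l)
                             (multiAffine-corners n (affine x) v w ls (f≡c ∘ (false ∷_)) ε)
                             (multiAffine-corners n (affine y) v w ls (f≡c ∘ (true ∷_)) ε) ⟩
    lineMap c c l      ≡⟨ lineMap-const c l ⟩
    c                  ∎
    where open ≡-Reasoning

module Counting (𝔽 : FiniteField) (s : ℕ) where

  open import Data.Bool using (true; false; T)
  open import Data.Bool.Properties using (T-∧)
  open import Data.Nat using (zero; suc; _*_; _^_; _≤_)
  open import Data.Nat.Properties using (module ≤-Reasoning)
  open import Data.List using (List; []; _∷_; length; map; filter; filterᵇ; findᵇ; cartesianProduct)
  open import Data.Nat.ListAction using (sum)
  open import Data.List.Membership.Propositional using (_∈_)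
  open import Data.List.Membership.Propositional.Properties
    using (∈-filter⁺; ∈-filter⁻; ∈-cartesianProduct⁺; ∈-cartesianProduct⁻)
  open import Data.List.Relation.Unary.Any using (here; there)
  import Data.List.Relation.Unary.All as ListAll
  open import Data.List.Relation.Unary.All.Properties using (all⁺; all⁻)
  import Data.List.Relation.Unary.Unique.Propositional.Properties as Unique
  open import Data.Maybe using (fromMaybe)
  open import Data.Product using (_×_; _,_; proj₁; proj₂)
  open import Data.Product.Properties using (,-injective)
  open import Data.Vec using (Vec; []; _∷_; zip)
  open import Data.Vec.Relation.Unary.All as All using (All; []; _∷_; universal)
  open import Data.Vec.Relation.Binary.Pointwise.Inductive using (Pointwise; []; _∷_)
  open import Function using (_∘_; _⇔_; mk⇔; Equivalence; const; case_of_)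
  open import Relation.Binary.PropositionalEquality
  open import Relation.Nullary using (Dec; yes; no; does; ¬?)
  open import Relation.Nullary.Decidable using (T?)

  open FiniteField 𝔽 using (Carrier; _≟_; 0#; 1#; elements; complete; unique; order)
  open Setting 𝔽 s
  open LineMap 𝔽 using (lineMaps; lineMaps-≢; lineMaps-injective)
  open MultiAffine 𝔽 s using (corner; multiAffine-corners; eval-multiAffine)
  open Enumeration
  open Equivalence using (to; from)

  private
    T-does : ∀ {P : Set} (p? : Dec P) → T (does p?) ⇔ P
    T-does (yes p) = mk⇔ (const p) (const _)
    T-does (no ¬p) = mk⇔ (λ ()) (λ p → ¬p p)

  nonzeros : List Carrier
  nonzeros = filter (λ x → ¬? (x ≟ 0#)) elements

  ∈-nonzeros⁻ : ∀ {x} → x ∈ nonzeros → x ≢ 0#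
  ∈-nonzeros⁻ = proj₂ ∘ ∈-filter⁻ (λ x → ¬? (x ≟ 0#)) {xs = elements}

  order≤1+nonzeros : order ≤ suc (length nonzeros)
  order≤1+nonzeros = Unique-⊆⇒length-≤ unique λ {x} _ → case x ≟ 0# of λ where
    (yes refl) → here refl
    (no x≢0)   → there (∈-filter⁺ _ (complete x) x≢0)

  OneOn : ∀ {n} → Vec Vs n → Tensor n → Set
  OneOn u T = eval T u ≡ 1#

  InF : ∀ {n k} → Vec (Tensor n) k → Vec Vs n → Vec Vs n → Set
  InF Ts v w = Pointwise _≢_ v w × (∀ ε → All (OneOn (corner v w ε)) Ts)

  T-allOneAt : ∀ n k (Ts : Vec (Tensor n) k) {u} → T (allOneAt n k Ts u) ⇔ All (OneOn u) Ts
  T-allOneAt n zero    []       = mk⇔ (const []) (const _)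
  T-allOneAt n (suc k) (T ∷ Ts) = mk⇔
    (λ h → let t , ts = to T-∧ h in to (T-does (_ ≟ 1#)) t ∷ to (T-allOneAt n k Ts) ts)
    (λ { (t ∷ ts) → from T-∧ (from (T-does (_ ≟ 1#)) t , from (T-allOneAt n k Ts) ts) })

  T-distinctPairs : ∀ n k {v w : Vec Vs n} → T (distinctPairs n k (zip v w)) ⇔ Pointwise _≢_ v w
  T-distinctPairs zero    k {[]}    {[]}    = mk⇔ (const []) (const _)
  T-distinctPairs (suc n) k {a ∷ v} {b ∷ w} = mk⇔
    (λ h → let a≢b , v≢w = to T-∧ h in to (T-does (¬? (a ≟V b))) a≢b ∷ to (T-distinctPairs n k) v≢w)
    (λ { (a≢b ∷ v≢w) → from T-∧ (from (T-does (¬? (a ≟V b))) a≢b , from (T-distinctPairs n k) v≢w) })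

  select-zip : ∀ n k (v w : Vec Vs n) ε → select n k (zip v w) ε ≡ corner v w ε
  select-zip zero    k []      []      []      = refl
  select-zip (suc n) k (_ ∷ v) (_ ∷ w) (_ ∷ ε) = cong (_ ∷_) (select-zip n k v w ε)

  ∈-allEps : ∀ n k ε → ε ∈ allEps n k
  ∈-allEps n k = ∈-vecsOver⁺ ∘ universal λ where
    false → here refl
    true  → there (here refl)

  T-inF : ∀ n k (Ts : Vec (Tensor n) k) {v w} → T (inF n k Ts (zip v w)) ⇔ InF Ts v w
  T-inF n k Ts {v} {w} = mk⇔
    (λ h → let v≢w , ones = to T-∧ h in
      to (T-distinctPairs n k) v≢w , λ ε →
        to (T-allOneAt n k Ts)
          (subst T′ (select-zip n k v w ε) (ListAll.lookup (all⁺ _ _ ones) (∈-allEps n k ε))))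
    (λ (v≢w , ones) → from T-∧
      ( from (T-distinctPairs n k) v≢w
      , all⁻ (allOneAt n k Ts ∘ select n k (zip v w)) {allEps n k} (ListAll.tabulate λ {ε} _ →
          subst T′ (sym (select-zip n k v w ε)) (from (T-allOneAt n k Ts) (ones ε)))))
    where T′ = T ∘ allOneAt n k Ts

  InF-lineMaps : ∀ {n k} (Ts : Vec (Tensor n) k) {v w ls} →
    InF Ts v w → All (_≢ 0#) ls → InF Ts v (lineMaps v w ls)
  InF-lineMaps {n} Ts {v} {w} {ls} (v≢w , ones) ls≢0 = lineMaps-≢ v≢w ls≢0 , corners Ts ones
    where
    corners : ∀ {k} (Ts : Vec (Tensor n) k) → (∀ ε → All (OneOn (corner v w ε)) Ts) →
      ∀ ε → All (OneOn (corner v (lineMaps v w ls) ε)) Ts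
    corners []       _    _ = []
    corners (T ∷ Ts) ones ε =
      multiAffine-corners n (eval-multiAffine n T) v w ls (All.head ∘ ones) ε ∷ corners Ts (All.tail ∘ ones) ε

  module _ (d r : ℕ) (Ts : Vec (Tensor d) r) where

    witness : Vec Vs d → Vec Vs d
    witness v = fromMaybe v (findᵇ (λ w → inF d r Ts (zip v w)) (allVd d r))

    witness-inF : ∀ {v} → T (inB d r Ts v) → InF Ts v (witness v)
    witness-inF {v} h = to (T-inF d r Ts)
      (findᵇ-satisfies (λ w → inF d r Ts (zip v w)) v (allVd d r) (proj₂ (to T-∧ h)))

    ℬ : List (Vec Vs d)
    ℬ = filterᵇ (inB d r Ts) (allVd d r)

    ℱ : List (Vec (Vs × Vs) d)
    ℱ = filterᵇ (inF d r Ts) (allPairs d r)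

    ℬ⁻ : ∀ {v} → v ∈ ℬ → T (inB d r Ts v)
    ℬ⁻ = proj₂ ∘ ∈-filter⁻ (T? ∘ inB d r Ts) {xs = allVd d r}

    box : Vec Vs d × Vec Carrier d → Vec (Vs × Vs) d
    box (v , ls) = zip v (lineMaps v (witness v) ls)

    Λ : List (Vec Carrier d)
    Λ = vecsOver nonzeros d

    box-∈ : ∀ {p} → p ∈ cartesianProduct ℬ Λ → box p ∈ ℱ
    box-∈ p∈ with v∈ℬ , ls∈Λ ← ∈-cartesianProduct⁻ ℬ Λ p∈ =
      ∈-filter⁺ (T? ∘ inF d r Ts) (∈-vecsOver⁺ (universal ∈-allPairs _))
        (from (T-inF d r Ts) (InF-lineMaps Ts (witness-inF (ℬ⁻ v∈ℬ)) ls≢0))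
      where
      ls≢0 = All.map ∈-nonzeros⁻ (∈-vecsOver⁻ nonzeros ls∈Λ)
      ∈-allV : ∀ x → x ∈ allV
      ∈-allV = ∈-vecsOver⁺ ∘ universal complete
      ∈-allPairs : ∀ p → p ∈ cartesianProduct allV allV
      ∈-allPairs (a , b) = ∈-cartesianProduct⁺ (∈-allV a) (∈-allV b)

    box-injective : ∀ {p p′} → p ∈ cartesianProduct ℬ Λ → box p ≡ box p′ → p ≡ p′
    box-injective p∈ eq
      with v∈ℬ , _ ← ∈-cartesianProduct⁻ ℬ Λ p∈ | refl , lineMaps≡ ← ,-injective (zip-injective eq) =
      cong (_ ,_) (lineMaps-injective (proj₁ (witness-inF (ℬ⁻ v∈ℬ))) lineMaps≡)

    sizeB*nonzeros^d≤sizeF : sizeB d r Ts * length nonzeros ^ d ≤ sizeF d r Ts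
    sizeB*nonzeros^d≤sizeF = begin
      length ℬ * length nonzeros ^ d  ≡⟨ cong (length ℬ *_) (length-vecsOver nonzeros d) ⟨
      length ℬ * length Λ             ≡⟨ length-cartesianProductWith _,_ ℬ Λ ⟨
      length (cartesianProduct ℬ Λ)   ≤⟨ length-≤-injectiveOn box ℬ×Λ-unique box-∈ (λ p∈ _ → box-injective p∈) ⟩
      length ℱ                        ∎
      where
      open ≤-Reasoning
      ℬ×Λ-unique = Unique.cartesianProduct⁺
        (Unique.filter⁺ (T? ∘ inB d r Ts) (vecsOver⁺ (vecsOver⁺ unique)))
        (vecsOver⁺ (Unique.filter⁺ (λ x → ¬? (x ≟ 0#)) unique))

  ΣsizeB*nonzeros^d≤ΣsizeF : ∀ d r →
    sum (map (sizeB d r) (allTs d r)) * length nonzeros ^ d ≤ sum (map (sizeF d r) (allTs d r))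
  ΣsizeB*nonzeros^d≤ΣsizeF d r =
    sum-map-*-≤ (allTs d r) (sizeB d r) (sizeF d r) (length nonzeros ^ d) (sizeB*nonzeros^d≤sizeF d r)

module Asymptotics where

  open import Data.Nat using (zero; suc; _+_; _*_; _^_; _≤_)
  open import Data.Nat.Properties
  open import Data.Nat.Tactic.RingSolver using (solve-∀)
  open import Relation.Binary.PropositionalEquality using (_≡_)
  open ≤-Reasoning

  [1+m]^[1+e]≤m^[1+e]+[1+e]*[1+m]^e : ∀ m e → suc m ^ suc e ≤ m ^ suc e + suc e * suc m ^ e
  [1+m]^[1+e]≤m^[1+e]+[1+e]*[1+m]^e m zero    = ≤-reflexive (eq m)
    where
    eq : ∀ m → suc m * 1 ≡ m * 1 + 1 * 1
    eq = solve-∀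
  [1+m]^[1+e]≤m^[1+e]+[1+e]*[1+m]^e m (suc e) = begin
    P * (P * B)                      ≤⟨ *-monoʳ-≤ P ([1+m]^[1+e]≤m^[1+e]+[1+e]*[1+m]^e m e) ⟩
    P * (A + suc e * B)              ≡⟨ expand m A B e ⟩
    m * A + A + suc e * (P * B)      ≤⟨ +-monoˡ-≤ (suc e * (P * B)) (+-monoʳ-≤ (m * A) (^-monoˡ-≤ (suc e) (n≤1+n m))) ⟩
    m * A + P * B + suc e * (P * B)  ≡⟨ collect m A B e ⟩
    m * A + suc (suc e) * (P * B)    ∎
    where
    P = suc m
    A = m ^ suc e
    B = P ^ e
    expand : ∀ m A B e → suc m * (A + suc e * B) ≡ m * A + A + suc e * (suc m * B)
    expand = solve-∀
    collect : ∀ m A B e → m * A + suc m * B + suc e * (suc m * B) ≡ m * A + suc (suc e) * (suc m * B)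
    collect = solve-∀

  K*[1+m]^[1+e]≤[1+K]*m^[1+e] : ∀ K m e → suc K * suc e ≤ m → K * suc m ^ suc e ≤ suc K * m ^ suc e
  K*[1+m]^[1+e]≤[1+K]*m^[1+e] K m e [1+K][1+e]≤m = +-cancelˡ-≤ X _ _ (begin
    X + K * X                        ≤⟨ *-monoʳ-≤ (suc K) ([1+m]^[1+e]≤m^[1+e]+[1+e]*[1+m]^e m e) ⟩
    suc K * (Y + suc e * B)          ≡⟨ distribute K Y e B ⟩
    suc K * Y + (suc K * suc e) * B  ≤⟨ +-monoʳ-≤ (suc K * Y) (*-monoˡ-≤ B (m≤n⇒m≤1+n [1+K][1+e]≤m)) ⟩
    suc K * Y + X                    ≡⟨ +-comm (suc K * Y) X ⟩
    X + suc K * Y                    ∎)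
    where
    X = suc m ^ suc e
    Y = m ^ suc e
    B = suc m ^ e
    distribute : ∀ K Y e B → suc K * (Y + suc e * B) ≡ suc K * Y + (suc K * suc e) * B
    distribute = solve-∀

  K*q^[1+e]≤[1+K]*m^[1+e] : ∀ K q m e → suc (suc K * suc e) ≤ q → q ≤ suc m → K * q ^ suc e ≤ suc K * m ^ suc e
  K*q^[1+e]≤[1+K]*m^[1+e] K q m e Q≤q q≤1+m = ≤-trans (*-monoʳ-≤ K (^-monoˡ-≤ (suc e) q≤1+m))
    (K*[1+m]^[1+e]≤[1+K]*m^[1+e] K m e (≤-pred (≤-trans Q≤q q≤1+m)))

module Ratio where

  open import Data.Nat as ℕ using (zero; suc; z≤n; s≤s)
  import Data.Nat.Properties as ℕ
  open import Data.Nat.Coprimality using (Coprime)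
  open import Data.Nat.Tactic.RingSolver using (solve-∀)
  open import Data.Integer as ℤ using (+_; +0; +[1+_]; -[1+_]; +≤+; +<+)
  import Data.Integer.Properties as ℤ
  open import Data.Rational using (ℚ; mkℚ; 0ℚ; 1ℚ; _+_; _*_; toℚᵘ; _≤_; _<_; *<*; ↧ₙ_)
  open import Data.Rational.Properties using (toℚᵘ-fromℚᵘ; toℚᵘ-cancel-≤; toℚᵘ-homo-+; toℚᵘ-homo-*)
  open import Data.Rational.Unnormalised as ℚᵘ using (ℚᵘ; mkℚᵘ; _≃_; *≤*)
  import Data.Rational.Unnormalised.Properties as ℚᵘ
  open import Relation.Binary.PropositionalEquality

  toℚᵘ-÷ : ∀ a b → toℚᵘ (a ÷ suc b) ≃ mkℚᵘ (+ a) b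
  toℚᵘ-÷ a b = toℚᵘ-fromℚᵘ (mkℚᵘ (+ a) b)

  mkℚᵘ-mono-≤ : ∀ {a b c e} → a ℕ.* suc e ℕ.≤ c ℕ.* suc b → mkℚᵘ (+ a) b ℚᵘ.≤ mkℚᵘ (+ c) e
  mkℚᵘ-mono-≤ {a} {b} {c} {e} h = *≤* (subst₂ ℤ._≤_ (ℤ.pos-* a (suc e)) (ℤ.pos-* c (suc b)) (+≤+ h))

  mkℚᵘ-+ : ∀ a b c e → mkℚᵘ (+ a) b ℚᵘ.+ mkℚᵘ (+ c) e ≡ mkℚᵘ (+ (a ℕ.* suc e ℕ.+ c ℕ.* suc b)) (e ℕ.+ b ℕ.* suc e)
  mkℚᵘ-+ a b c e = cong (λ z → mkℚᵘ z (e ℕ.+ b ℕ.* suc e))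
    (trans (cong₂ ℤ._+_ (sym (ℤ.pos-* a (suc e))) (sym (ℤ.pos-* c (suc b))))
           (sym (ℤ.pos-+ (a ℕ.* suc e) (c ℕ.* suc b))))

  mkℚᵘ-* : ∀ a b c e → mkℚᵘ (+ a) b ℚᵘ.* mkℚᵘ (+ c) e ≡ mkℚᵘ (+ (a ℕ.* c)) (e ℕ.+ b ℕ.* suc e)
  mkℚᵘ-* a b c e = cong (λ z → mkℚᵘ z (e ℕ.+ b ℕ.* suc e)) (sym (ℤ.pos-* a c))

  private
    -- The factors 1 * _ and _ * 1 are those of the normal form computed by ℚᵘ arithmetic.
    cross-multiplied : ∀ {a b M} K P N m → 1 ℕ.≤ m → a ℕ.* M ℕ.≤ b → K ℕ.* P ℕ.≤ suc K ℕ.* M →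
      a ℕ.* ((1 ℕ.* K) ℕ.* (P ℕ.* N)) ℕ.≤ ((1 ℕ.* K ℕ.+ m ℕ.* 1) ℕ.* (1 ℕ.* b)) ℕ.* N
    cross-multiplied {a} {b} {M} K P N m 1≤m a*M≤b KP≤[1+K]M = begin
      a ℕ.* ((1 ℕ.* K) ℕ.* (P ℕ.* N))  ≡⟨ regroup a K P N ⟩
      (K ℕ.* P) ℕ.* (a ℕ.* N)          ≤⟨ ℕ.*-monoˡ-≤ (a ℕ.* N) KP≤[1+K]M ⟩
      (suc K ℕ.* M) ℕ.* (a ℕ.* N)      ≡⟨ regroup′ K M a N ⟩
      ((K ℕ.+ 1) ℕ.* (a ℕ.* M)) ℕ.* N  ≤⟨ ℕ.*-monoˡ-≤ N (ℕ.*-mono-≤ (ℕ.+-monoʳ-≤ K 1≤m) a*M≤b) ⟩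
      ((K ℕ.+ m) ℕ.* b) ℕ.* N          ≡⟨ pad K m b N ⟩
      ((1 ℕ.* K ℕ.+ m ℕ.* 1) ℕ.* (1 ℕ.* b)) ℕ.* N  ∎
      where
      open ℕ.≤-Reasoning
      regroup : ∀ a K P N → a ℕ.* ((1 ℕ.* K) ℕ.* (P ℕ.* N)) ≡ (K ℕ.* P) ℕ.* (a ℕ.* N)
      regroup = solve-∀
      regroup′ : ∀ K M a N → (suc K ℕ.* M) ℕ.* (a ℕ.* N) ≡ ((K ℕ.+ 1) ℕ.* (a ℕ.* M)) ℕ.* N
      regroup′ = solve-∀
      pad : ∀ K m b N → ((K ℕ.+ m) ℕ.* b) ℕ.* N ≡ ((1 ℕ.* K ℕ.+ m ℕ.* 1) ℕ.* (1 ℕ.* b)) ℕ.* N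
      pad = solve-∀

    ÷suc-≤ : ∀ a b N P {M e′ n} .{c : Coprime (suc n) (suc e′)} →
      a ℕ.* M ℕ.≤ b → suc e′ ℕ.* suc P ℕ.≤ suc (suc e′) ℕ.* M →
      a ÷ suc N ≤ (1ℚ + mkℚ +[1+ n ] e′ c) * ((1 ÷ suc P) * (b ÷ suc N))
    ÷suc-≤ a b N P {M} {e′} {n} {c} a*M≤b KP≤[1+K]M = toℚᵘ-cancel-≤ (begin
      toℚᵘ (a ÷ suc N)  ≃⟨ toℚᵘ-÷ a N ⟩
      mkℚᵘ (+ a) N      ≤⟨ mkℚᵘ-mono-≤ (cross-multiplied {a} {b} {M} K (suc P) (suc N) (suc n) (s≤s z≤n)
                                                      a*M≤b KP≤[1+K]M) ⟩
      _                 ≡⟨ normalForm ⟨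
      (mkℚᵘ (+ 1) 0 ℚᵘ.+ mkℚᵘ (+ suc n) e′) ℚᵘ.* (mkℚᵘ (+ 1) P ℚᵘ.* mkℚᵘ (+ b) N)  ≃⟨ homo ⟨
      toℚᵘ ((1ℚ + ε) * ((1 ÷ suc P) * (b ÷ suc N)))  ∎)
      where
      open ℚᵘ.≤-Reasoning
      ε = mkℚ +[1+ n ] e′ c
      K = suc e′
      homo = ℚᵘ.≃-trans (toℚᵘ-homo-* (1ℚ + ε) _) (ℚᵘ.*-cong (toℚᵘ-homo-+ 1ℚ ε)
        (ℚᵘ.≃-trans (toℚᵘ-homo-* (1 ÷ suc P) _) (ℚᵘ.*-cong (toℚᵘ-÷ 1 P) (toℚᵘ-÷ b N))))
      normalForm = trans (cong₂ ℚᵘ._*_ (mkℚᵘ-+ 1 0 (suc n) e′) (mkℚᵘ-* 1 P b N))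
        (mkℚᵘ-* (1 ℕ.* K ℕ.+ suc n ℕ.* 1) (e′ ℕ.+ 0 ℕ.* K) (1 ℕ.* b) (N ℕ.+ P ℕ.* suc N))

  -- Since x ÷ 0 is 0 ÷ 1, the case N = 0 is the case N = 1 with a = b = 0.
  ÷-≤ : ∀ a b N {M P} (ε : ℚ) → 0ℚ < ε →
    a ℕ.* M ℕ.≤ b → 1 ℕ.≤ P → ↧ₙ ε ℕ.* P ℕ.≤ suc (↧ₙ ε) ℕ.* M →
    a ÷ N ≤ (1ℚ + ε) * ((1 ÷ P) * (b ÷ N))
  ÷-≤ a b zero    {M} (mkℚ +[1+ n ] e′ c) _ _     (s≤s {n = P} z≤n) = ÷suc-≤ 0 0 0 P {M} {e′} {n} {c} z≤n
  ÷-≤ a b (suc N) {M} (mkℚ +[1+ n ] e′ c) _ a*M≤b (s≤s {n = P} z≤n) = ÷suc-≤ a b N P {M} {e′} {n} {c} a*M≤b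
  ÷-≤ a b N (mkℚ +0       _ _) (*<* (+<+ ()))
  ÷-≤ a b N (mkℚ -[1+ _ ] _ _) (*<* ())

open import Data.Nat using (ℕ; _≤_; _^_)
open import Data.Product using (∃)
open import Data.Rational using (ℚ; 0ℚ; 1ℚ; _+_; _*_; _<_)
open import Data.Rational using () renaming (_≤_ to _≤ℚ_)
open import Data.Nat as ℕ using (zero; suc; s≤s; z≤n; >-nonZero)
open import Data.Nat.Properties using (≤-trans; m^n>0)
open import Data.Nat.ListAction using (sum)
open import Data.List using (map; length)
open import Data.Product using (_,_)
open import Data.Rational using (↧ₙ_)
open Ratio using (÷-≤)
open Asymptotics using (K*q^[1+e]≤[1+K]*m^[1+e])

lemma9 : (d r s : ℕ) → 1 ≤ d → 1 ≤ r → 1 ≤ s →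
    (ε : ℚ) → 0ℚ < ε →
    ∃ λ (Q : ℕ) → (𝔽 : FiniteField) → Q ≤ FiniteField.order 𝔽 →
    Setting.EB 𝔽 s d r
    ≤ℚ ((1ℚ + ε) * ((1 ÷ (FiniteField.order 𝔽 ^ d)) * Setting.EF 𝔽 s d r))
lemma9 zero    _ _ () _ _ _ _
lemma9 (suc e) r s _ _ _ ε 0<ε = suc (suc K ℕ.* d) , λ 𝔽 Q≤q →
  let open Setting 𝔽 s using (allTs; sizeB; sizeF)
      open Counting 𝔽 s using (nonzeros; order≤1+nonzeros; ΣsizeB*nonzeros^d≤ΣsizeF)
      q = FiniteField.order 𝔽
  in ÷-≤ (sum (map (sizeB d r) (allTs d r))) (sum (map (sizeF d r) (allTs d r))) (length (allTs d r)) ε 0<ε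
       (ΣsizeB*nonzeros^d≤ΣsizeF d r)
       (m^n>0 q {{>-nonZero (≤-trans (s≤s z≤n) Q≤q)}} d)
       (K*q^[1+e]≤[1+K]*m^[1+e] K q (length nonzeros) e Q≤q order≤1+nonzeros)
  where
  d = suc e
  K = ↧ₙ ε
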